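{- Let $T$ be a based scheme on $X$, $U$ a based scheme on $Y$, and $S$ a based scheme on $Z$, with $\tilde T\subseteq S$ a closed subset, $i:U\to S$ a based morphism with $i\pi:U\to S/\!\!/\tilde T$ an isomorphism, and the condition $|t(ui)|=1$ for all $u\in U$, $t\in\tilde T$ holding, exactly as in the context. Let $\zeta$ be the action of $U$ on $T$ constructed from these data as in the context. Then the scheme $S$ on $Z$ is isomorphic to the scheme $U\ltimes_\zeta T$ on $Y\times X$.
   Context: All schemes are association schemes on finite sets. For a scheme $S$ on $X$, $x\in X$, $s\in S$: $xs=\{y:(x,y)\in s\}$, and for $P\subseteq S$, $xP=\bigcup_{s\in P}xs$. For $p,q\in S$, $pq=\{r\in S: a_{pqr}>0\}$ (complex product), extended to subsets by unions. $T\subseteq S$ is closed if $T^*T\subseteq T$, normal if $pT=Tp$ for all $p\in S$. For closed $T$: $X/T=\{xT\}$, $s^T=\{(x_1T,x_2T):(x_1',x_2')\in s$ for some $x_1'\in x_1T,x_2'\in x_2T\}$, and $S/\!\!/T=\{s^T:s\in S\}$ is a scheme on $X/T$; $\pi:S\to S/\!\!/T$ is the natural morphism. The subscheme defined by a coset $xT$ is $\{t\cap(xT\times xT):t\in T\}$. A morphism of schemes $\phi$ from $S$ on $X$ to $S'$ on $X'$ is a map $\phi_X:X\to X'$ such that pairs lying in a common element of $S$ are sent to pairs lying in a common element of $S'$; it induces $\phi_S:S\to S'$; it is an isomorphism if $\phi_X,\phi_S$ are bijective. We write $x\phi$, $s\phi$ for images. A based scheme is a scheme on a set with a basepoint; quotients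 are based at the coset of the basepoint; based morphisms preserve basepoints. Category $\mathcal C$: for based schemes $T$ on $X$ and $U$ on $Y$, a morphism $\phi\in\mathrm{Hom}_{\mathcal C}(T,U)$ is a triple: a normal closed subset $T_\phi\subseteq T$, a normal closed subset $U_\phi\subseteq U$, and a based isomorphism $\tilde\phi:T/\!\!/T_\phi\to U/\!\!/U_\phi$. Composition of $\phi\in\mathrm{Hom}_{\mathcal C}(T,U)$, $\psi\in\mathrm{Hom}_{\mathcal C}(U,V)$ ($V$ on $W$): $T_{\phi\psi}=\{t\in T:\exists u\in U,\ t^{T_\phi}\tilde\phi=u^{U_\phi},\ u^{U_\psi}\tilde\psi=1_W^{V_\psi}\}$, $V_{\phi\psi}=\{v\in V:\exists u\in U,\ 1_X^{T_\phi}\tilde\phi=u^{U_\phi},\ u^{U_\psi}\tilde\psi=v^{V_\psi}\}$, $(xT_{\phi\psi})\widetilde{\phi\psi}=wV_{\phi\psi}$ where $y$ satisfies $(xT_\phi)\tilde\phi=yU_\phi$ and $w$ satisfies $(yU_\psi)\tilde\psi=wV_\psi$. $\mathrm{id}_T=(\{1_X\},\{1_X\},\mathrm{id})$. $\phi\le\psi$ in $\mathrm{Hom}_{\mathcal C}(T,U)$ means $T_\phi\subseteq T_\psi$, $U_\phi\subseteq U_\psi$, $(xT_\phi)\tilde\phi\subseteq (xT_\psi)\tilde\psi$ for all $x\in X$. For $\phi\in\mathrm{Hom}_{\mathcal C}(T,U)$, $\phi^*\in\mathrm{Hom}_{\mathcal C}(U,T)$ has the same two normal closed subsets and isomorphism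 $\tilde\phi^{ -1}$. Labelling: for a scheme $T$ on $X$, $\tau=\tau_T$ is the set $T$ with its involution, distinguished element $1=1_X$ and constants $a_{pqr}$. A $\tau$-scheme is a pair $(T',\alpha)$, $T'$ a scheme on a based set, $\alpha:\tau\to T'$ a bijection with $1\alpha$ the diagonal, $(p^*)\alpha=(p\alpha)^*$, $a_{(p\alpha)(q\alpha)(r\alpha)}=a_{pqr}$. If $(T_1,\alpha),(T_2,\beta)$ are $\tau$-schemes and $\phi\in\mathrm{Hom}_{\mathcal C}(T_1,T_2)$, $\phi(\tau):\mathcal P(\tau)\to\mathcal P(\tau)$ sends $P$ to $\{u\in\tau:(t\alpha)^{(T_1)_\phi}\tilde\phi=(u\beta)^{(T_2)_\phi}$ for some $t\in P\}$. Action: for based schemes $T$ on $X$ (basepoint $x_*$), $U$ on $Y$ (basepoint $y_*$), $\tau=\tau_T$, an action $\zeta$ of $U$ on $T$ is: a $\tau$-scheme $\zeta_y=(T_y,\alpha^y)$ with $T_y$ a scheme on $X$, for each $y\in Y$, and $\zeta_{y_1}^{y_2}\in\mathrm{Hom}_{\mathcal C}(T_{y_1},T_{y_2})$ for all $y_1,y_2\in Y$, with (1) $T_{y_*}=T$, $\alpha^{y_*}=\mathrm{id}$; (2) $\zeta_y^y=\mathrm{id}_{T_y}$; (3) $\zeta_{y_2}^{y_1}=(\zeta_{y_1}^{y_2})^*$; (4) $\zeta_{y_1}^{y_2}(\tau)$ depends only on the $u\in U$ containing $(y_1,y_2)$; (5) $\zeta_{y_1}^{y_3}\le\zeta_{y_1}^{y_2}\zeta_{y_2}^{y_3}$.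 Write $T'_{y_1y_2}=(T_{y_1})_{\zeta_{y_1}^{y_2}}$, $T''_{y_1y_2}=(T_{y_2})_{\zeta_{y_1}^{y_2}}$. For $u\in U$, $t\in\tau$, $[u,t]$ is the set of $((y_1,x_1),(y_2,x_2))\in(Y\times X)^2$ with $(y_1,y_2)\in u$ and $((x_1T'_{y_1y_2})\tilde\zeta_{y_1}^{y_2},x_2T''_{y_1y_2})\in(t\alpha^{y_2})^{T''_{y_1y_2}}$; $U\ltimes_\zeta T=\{[u,t]\}$. Setting: $T$ based on $X$ (basepoint $x_*$), $U$ based on $Y$ (basepoint $y_*$), $S$ based on $Z$ (basepoint $z_*$); $\tilde T\subseteq S$ closed with a based isomorphism $\gamma$ from $T$ to the subscheme $\tilde T_{y_*}$ of $S$ defined by $z_*\tilde T$ (based at $z_*$); $i:U\to S$ a based morphism with $i\pi:U\to S/\!\!/\tilde T$ an isomorphism; and $|t(ui)|=1$ for all $u\in U$, $t\in\tilde T$. Construction of $\zeta$: for $y\in Y$, $\tilde T_y$ is the subscheme of $S$ defined by $(yi)\tilde T$, based at $yi$, and $\delta^y:\tilde T_y\to\tilde T$ sends $t\cap((yi)\tilde T)^2$ to $t$. Choose based bijections $\gamma^y_X:X\to(yi)\tilde T$ with $\gamma^{y_*}_X=\gamma_X$. $T_y$ is the scheme on $X$ making $\gamma^y_X$ a based isomorphism $\gamma^y:T_y\to\tilde T_y$ (so $T_{y_*}=T$); $\alpha^y:\tau\to T_y$ is given by $(t\alpha^y)\gamma^y\delta^y=t\gamma\delta^{y_*}$. For $u\in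 U$: $\tilde T'_u=\{t\in\tilde T:t(ui)=\{ui\}\}$, $\tilde T''_u=\{t\in\tilde T:(ui)t=\{ui\}\}$, $\tau'_u=\{t\in\tau:t\gamma\delta^{y_*}\in\tilde T'_u\}$, $\tau''_u=\{t\in\tau:t\gamma\delta^{y_*}\in\tilde T''_u\}$. For $(y_1,y_2)\in u$: $\zeta_{y_1}^{y_2}$ has subsets $T'_{y_1y_2}=\tau'_u\alpha^{y_1}$, $T''_{y_1y_2}=\tau''_u\alpha^{y_2}$, and $\tilde\zeta_{y_1}^{y_2}$ sends $xT'_{y_1y_2}$ to $(z_2(\gamma^{y_2}_X)^{ -1})T''_{y_1y_2}$ where $z_2$ is any element of $(x\gamma^{y_1}_X)(ui)\cap(y_2i)\tilde T$. These data constitute an action $\zeta$ of $U$ on $T$. -}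

module Defs where

open import Data.Nat using (ℕ; _<_)
open import Data.Fin using (Fin; _≟_)
open import Data.List using (length; filter)
open import Data.List.Base using (allFin)
open import Data.Product using (Σ; ∃; _×_; _,_; proj₁; proj₂)
open import Relation.Nullary.Decidable using (_×-dec_)
open import Relation.Binary.PropositionalEquality using (_≡_)

infix 3 _iff_
_iff_ : Set → Set → Set
A iff B = (A → B) × (B → A)

IsBij : {A B : Set} → (A → B) → Set
IsBij {A} {B} f = (∀ a b → f a ≡ f b → a ≡ b) × (∀ b → ∃ λ a → f a ≡ b)

-- Association schemes on a finite set Fin n.
-- The basis relations are indexed by Fin m ("colours"); rel x y is the
-- unique basis relation containing (x , y).

interCount : {n m : ℕ} → (Fin n → Fin n → Fin m) → Fin n → Fin n → Fin m → Fin m → ℕ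
interCount {n} rel x y p q =
  length (filter (λ z → (rel x z ≟ p) ×-dec (rel z y ≟ q)) (allFin n))

record Scheme (n : ℕ) : Set where
  field
    m       : ℕ
    rel     : Fin n → Fin n → Fin m
    one     : Fin m
    one-diag : ∀ x y → (rel x y ≡ one) iff (x ≡ y)
    inv     : Fin m → Fin m
    rel-inv : ∀ x y → rel y x ≡ inv (rel x y)
    -- every basis relation is nonempty (rep s is a pair in s)
    rep     : Fin m → Fin n × Fin n
    rep-ok  : ∀ s → rel (proj₁ (rep s)) (proj₂ (rep s)) ≡ s
    -- intersection numbers are well defined
    regular : ∀ p q x y x' y' → rel x y ≡ rel x' y' →
              interCount rel x y p q ≡ interCount rel x' y' p q

  _∋_ : Fin m → Fin n × Fin n → Set
  s ∋ (x , y) = rel x y ≡ s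

  a : Fin m → Fin m → Fin m → ℕ
  a p q r = interCount rel (proj₁ (rep r)) (proj₂ (rep r)) p q

  -- complex product: r ∈ pq  iff  a_{pqr} > 0
  InProd : Fin m → Fin m → Fin m → Set
  InProd r p q = 0 < a p q r

  Closed : (Fin m → Set) → Set
  Closed P = ∀ p q r → P p → P q → InProd r (inv p) q → P r

  InCoset : (Fin m → Set) → Fin n → Fin n → Set
  InCoset P x z = P (rel x z)

  -- pairs of points whose cosets (xP , yP) lie in s^P  (quotient relation)
  QuotRel : (Fin m → Set) → Fin m → Fin n → Fin n → Set
  QuotRel P s x y = ∃ λ x' → ∃ λ y' → InCoset P x x' × InCoset P y y' × rel x' y' ≡ s

open Scheme public

record Setting : Set₁ where
  field
    nX nY nZ : ℕ
    T : Scheme nX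
    U : Scheme nY
    S : Scheme nZ
    x* : Fin nX
    y* : Fin nY
    z* : Fin nZ
    T̃ : Fin (m S) → Set
    T̃-closed : Closed S T̃
    -- based isomorphism γ : T → subscheme of S defined by z* T̃.
    -- γS t is the element t γ δ^{y*} of T̃, i.e. t γ = γS t ∩ (z*T̃)².
    γX : Fin nX → Fin nZ
    γS : Fin (m T) → Fin (m S)
    γX-base : γX x* ≡ z*
    γX-into : ∀ x → InCoset S T̃ z* (γX x)
    γX-onto : ∀ z → InCoset S T̃ z* z → ∃ λ x → γX x ≡ z
    γX-inj  : ∀ x x' → γX x ≡ γX x' → x ≡ x'
    γS-into : ∀ t → T̃ (γS t)
    γS-onto : ∀ s → T̃ s → ∃ λ t → γS t ≡ s
    γS-inj  : ∀ t t' → γS t ≡ γS t' → t ≡ t'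
    γ-hom   : ∀ x x' → rel S (γX x) (γX x') ≡ γS (rel T x x')
    iX : Fin nY → Fin nZ
    iX-base : iX y* ≡ z*
    iX-hom  : ∀ y₁ y₂ y₁' y₂' → rel U y₁ y₂ ≡ rel U y₁' y₂' →
              rel S (iX y₁) (iX y₂) ≡ rel S (iX y₁') (iX y₂')

  iS : Fin (m U) → Fin (m S)
  iS u = rel S (iX (proj₁ (rep U u))) (iX (proj₂ (rep U u)))

  field
    -- i π : U → S//T̃ is an isomorphism.
    -- point map y ↦ (yi)T̃ is bijective onto Z/T̃
    iπ-pts-inj  : ∀ y y' → InCoset S T̃ (iX y) (iX y') → y ≡ y'
    iπ-pts-onto : ∀ z → ∃ λ y → InCoset S T̃ (iX y) z
    -- relation map u ↦ (ui)^T̃ is bijective onto S//T̃ = {s^T̃}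
    iπ-rel-inj  : ∀ u u' → (∀ z₁ z₂ → QuotRel S T̃ (iS u) z₁ z₂ iff QuotRel S T̃ (iS u') z₁ z₂) → u ≡ u'
    iπ-rel-onto : ∀ s → ∃ λ u → ∀ z₁ z₂ → QuotRel S T̃ s z₁ z₂ iff QuotRel S T̃ (iS u) z₁ z₂
    -- |t (ui)| = 1 for all u ∈ U, t ∈ T̃
    single : ∀ u t → T̃ t → ∃ λ r → ∀ r' → (InProd S r' t (iS u)) iff (r' ≡ r)

-- The choice of based bijections γ^y_X : X → (yi)T̃ with γ^{y*}_X = γ_X.

record Choices (σ : Setting) : Set₁ where
  open Setting σ
  field
    g : Fin nY → Fin nX → Fin nZ
    g-base  : ∀ x → g y* x ≡ γX x
    g-based : ∀ y → g y x* ≡ iX y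
    g-into  : ∀ y x → InCoset S T̃ (iX y) (g y x)
    g-onto  : ∀ y z → InCoset S T̃ (iX y) z → ∃ λ x → g y x ≡ z
    g-inj   : ∀ y x x' → g y x ≡ g y x' → x ≡ x'

module Construction (σ : Setting) (c : Choices σ) where
  open Setting σ
  open Choices c

  τ : Set
  τ = Fin (m T)

  -- t α^y as a relation on X: (t α^y) γ^y δ^y = t γ δ^{y*}
  α : Fin nY → τ → Fin nX → Fin nX → Set
  α y t x x' = rel S (g y x) (g y x') ≡ γS t

  T̃′ : Fin (m U) → Fin (m S) → Set
  T̃′ u t = T̃ t × (∀ r → (InProd S r t (iS u)) iff (r ≡ iS u))
  T̃″ : Fin (m U) → Fin (m S) → Set
  T̃″ u t = T̃ t × (∀ r → (InProd S r (iS u) t) iff (r ≡ iS u))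

  τ′ τ″ : Fin (m U) → τ → Set
  τ′ u t = T̃′ u (γS t)
  τ″ u t = T̃″ u (γS t)

  -- x' ∈ x T'_{y₁y₂}  (T'_{y₁y₂} = τ'_u α^{y₁}, u ∋ (y₁,y₂))
  InT′ : Fin nY → Fin nY → Fin nX → Fin nX → Set
  InT′ y₁ y₂ x x' = ∃ λ t → τ′ (rel U y₁ y₂) t × α y₁ t x x'

  -- x' ∈ x T''_{y₁y₂}  (T''_{y₁y₂} = τ''_u α^{y₂})
  InT″ : Fin nY → Fin nY → Fin nX → Fin nX → Set
  InT″ y₁ y₂ x x' = ∃ λ t → τ″ (rel U y₁ y₂) t × α y₂ t x x'

  -- (x₁ T'_{y₁y₂}) ζ̃_{y₁}^{y₂} = x' T''_{y₁y₂}  holds when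
  -- x' γ^{y₂}_X = z₂ for some z₂ ∈ (x₁γ^{y₁}_X)(ui) ∩ (y₂i)T̃
  ZetaImg : Fin nY → Fin nY → Fin nX → Fin nX → Set
  ZetaImg y₁ y₂ x₁ x' =
    rel S (g y₁ x₁) (g y₂ x') ≡ iS (rel U y₁ y₂) × InCoset S T̃ (iX y₂) (g y₂ x')

  Bracket : Fin (m U) → τ → Fin nY × Fin nX → Fin nY × Fin nX → Set
  Bracket u t (y₁ , x₁) (y₂ , x₂) =
    rel U y₁ y₂ ≡ u ×
    ∃ λ x' → ZetaImg y₁ y₂ x₁ x' ×
      -- (x' T'' , x₂ T'') ∈ (t α^{y₂})^{T''}
      (∃ λ a → ∃ λ b → InT″ y₁ y₂ x' a × InT″ y₁ y₂ x₂ b × α y₂ t a b)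

  IsoToSemidirect : Set
  IsoToSemidirect =
    Σ (Fin nZ → Fin nY × Fin nX) λ φ →
      IsBij φ ×
      (∀ s → ∃ λ u → ∃ λ t → ∀ z₁ z₂ →
         (rel S z₁ z₂ ≡ s) iff Bracket u t (φ z₁) (φ z₂)) ×
      (∀ u t → ∃ λ s → ∀ z₁ z₂ →
         (rel S z₁ z₂ ≡ s) iff Bracket u t (φ z₁) (φ z₂))

module Submission where

open import Data.Nat using (ℕ; _<_)
open import Data.Fin using (Fin)
open import Data.List using (List; _∷_; length; filter)
open import Data.List.Base using (allFin)
open import Data.List.Relation.Unary.Any using (here)
open import Data.List.Membership.Propositional using (_∈_)
open import Data.List.Membership.Propositional.Properties
  using (∈-allFin; ∈-filter⁺; ∈-filter⁻; ∈-length)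
open import Data.Product using (∃; _×_; _,_; proj₁; proj₂)
open import Relation.Unary using (Decidable)
open import Relation.Binary.PropositionalEquality
  using (_≡_; refl; sym; trans; cong; cong₂; subst; module ≡-Reasoning)

open import Defs

-- Every z ∈ Z lies in exactly one coset (yi)T̃, and there it is x γ^y for a
-- unique x; this gives the bijection z ↦ (y , x).  A pair (z₁ , z₂) with
-- coset indices (y₁ , y₂) and u ∋ (y₁ , y₂) factors as z₁ –ui→ a –tγ→ z₂
-- with a ∈ (y₂i)T̃.  Because |t(ui)| = 1 (and hence also |(ui)t| = 1) the
-- class of (z₁ , z₂) in S is determined by (u , t), and the freedom in the
-- choice of a is absorbed by T̃″_u; this is exactly the description of
-- [u , t].

∃-member : {A : Set} (ys : List A) → 0 < length ys → ∃ (_∈ ys)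
∃-member (y ∷ _) _ = y , here refl

filter-nonempty⇒∃ : {A : Set} {P : A → Set} (P? : Decidable P) (xs : List A) →
                    0 < length (filter P? xs) → ∃ P
filter-nonempty⇒∃ P? xs h =
  let (x , x∈) = ∃-member (filter P? xs) h in x , proj₂ (∈-filter⁻ P? {xs = xs} x∈)

module SchemeProperties {n : ℕ} (S : Scheme n) where

  interCount-positive : ∀ {x y p q} →
    (0 < interCount (rel S) x y p q) iff (∃ λ z → rel S x z ≡ p × rel S z y ≡ q)
  interCount-positive =
      filter-nonempty⇒∃ _ (allFin n)
    , λ (z , z-via) → ∈-length (∈-filter⁺ _ (∈-allFin z) z-via)

  InProd-intro : ∀ {x y z p q} → rel S x z ≡ p → rel S z y ≡ q →
                 InProd S (rel S x y) p q
  InProd-intro {x} {y} {z} {p} {q} e₁ e₂ =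
    subst (0 <_) (regular S p q x y _ _ (sym (rep-ok S (rel S x y))))
      (proj₂ interCount-positive (z , e₁ , e₂))

  InProd-elim : ∀ {x y r p q} → InProd S r p q → rel S x y ≡ r →
                ∃ λ z → rel S x z ≡ p × rel S z y ≡ q
  InProd-elim {x} {y} {r} {p} {q} h e =
    proj₁ interCount-positive
      (subst (0 <_) (regular S p q _ _ x y (trans (rep-ok S r) (sym e))) h)

  path-transport : ∀ {x y x' y' z p q} → rel S x y ≡ rel S x' y' →
                   rel S x z ≡ p → rel S z y ≡ q →
                   ∃ λ z' → rel S x' z' ≡ p × rel S z' y' ≡ q
  path-transport e e₁ e₂ = InProd-elim (InProd-intro e₁ e₂) (sym e)

  rel-diag : ∀ x → rel S x x ≡ one S
  rel-diag x = proj₂ (one-diag S x x) refl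

  rel≡one⇒≡ : ∀ {x y} → rel S x y ≡ one S → x ≡ y
  rel≡one⇒≡ {x} {y} = proj₁ (one-diag S x y)

  rel-flip : ∀ {x y p} → rel S x y ≡ p → rel S y x ≡ inv S p
  rel-flip {x} {y} e = trans (rel-inv S x y) (cong (inv S) e)

  rel-flip-≡ : ∀ {x y x' y'} → rel S y x ≡ rel S y' x' → rel S x y ≡ rel S x' y'
  rel-flip-≡ {x} {y} {x'} {y'} e =
    trans (rel-flip e) (sym (rel-inv S y' x'))

  successor-exists : ∀ x s → ∃ λ y → rel S x y ≡ s
  successor-exists x s =
    let (y , e , _) = path-transport (trans (rel-diag _) (sym (rel-diag x)))
                                     (rep-ok S s) refl
    in y , e

  InProd-oneʳ : ∀ r p → (InProd S r p (one S)) iff (r ≡ p)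
  InProd-oneʳ r p = in-p·1⇒≡ , λ { refl → p∈p·1 }
    where
    in-p·1⇒≡ : InProd S r p (one S) → r ≡ p
    in-p·1⇒≡ h =
      let (_ , e₁ , e₂) = InProd-elim h (rep-ok S r)
      in trans (sym (rep-ok S r))
               (trans (cong (rel S _) (sym (rel≡one⇒≡ e₂))) e₁)
    p∈p·1 : InProd S p p (one S)
    p∈p·1 = subst (λ v → InProd S v p (one S)) (rep-ok S p)
                  (InProd-intro (rep-ok S p) (rel-diag _))

module CosetProperties {n : ℕ} (S : Scheme n) {P : Fin (m S) → Set}
                       (P-closed : Closed S P) (P-one : P (one S)) where
  open SchemeProperties S

  coset-closed : ∀ {z x y} → InCoset S P z x → InCoset S P z y → InCoset S P x y
  coset-closed {z} {x} {y} h₁ h₂ =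
    P-closed _ _ _ h₁ h₂ (InProd-intro (rel-inv S z x) refl)

  coset-refl : ∀ z → InCoset S P z z
  coset-refl z = subst P (sym (rel-diag z)) P-one

  coset-sym : ∀ {x y} → InCoset S P x y → InCoset S P y x
  coset-sym {x} h = coset-closed h (coset-refl x)

  coset-trans : ∀ {x y z} → InCoset S P x y → InCoset S P y z → InCoset S P x z
  coset-trans h₁ h₂ = coset-closed (coset-sym h₁) h₂

  QuotRel-overlap⇒⊆ : ∀ {p q a b a₂ b₂} →
    QuotRel S P p a b → QuotRel S P q a b → QuotRel S P p a₂ b₂ → QuotRel S P q a₂ b₂
  QuotRel-overlap⇒⊆ (a' , b' , ha' , hb' , e) (a'' , b'' , ha'' , hb'' , e')
                    (a₂' , b₂' , ha₂' , hb₂' , e₂)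
    with path-transport {z = a''} (trans e (sym e₂)) refl refl
  ... | a₂'' , f₁ , f₂ with path-transport {z = b''} (sym f₂) e' refl
  ... | b₂'' , g₁ , g₂ =
      a₂'' , b₂''
    , coset-trans ha₂' (subst P (sym f₁) (coset-trans (coset-sym ha') ha''))
    , coset-trans hb₂'
        (coset-sym (subst P (sym g₂) (coset-trans (coset-sym hb'') hb')))
    , g₁

module SemidirectDecomposition (σ : Setting) (c : Choices σ) where
  open Setting σ
  open Choices c
  open Construction σ c
  open SchemeProperties S
  module ST = SchemeProperties T

  γS-one : γS (one T) ≡ one S
  γS-one = begin
    γS (one T)               ≡⟨ cong γS (sym (ST.rel-diag x*)) ⟩
    γS (rel T x* x*)         ≡⟨ sym (γ-hom x* x*) ⟩
    rel S (γX x*) (γX x*)    ≡⟨ rel-diag _ ⟩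
    one S                    ∎
    where open ≡-Reasoning

  open CosetProperties S T̃-closed (subst T̃ γS-one (γS-into (one T)))

  iS-rel : ∀ y y' → iS (rel U y y') ≡ rel S (iX y) (iX y')
  iS-rel y y' = iX-hom _ _ y y' (rep-ok U (rel U y y'))

  iS-inv : ∀ u → iS (inv U u) ≡ inv S (iS u)
  iS-inv u = begin
    iS (inv U u)                     ≡⟨ cong (λ v → iS (inv U v)) (sym (rep-ok U u)) ⟩
    iS (inv U (rel U y₁ y₂))         ≡⟨ cong iS (sym (rel-inv U y₁ y₂)) ⟩
    iS (rel U y₂ y₁)                 ≡⟨ iS-rel y₂ y₁ ⟩
    rel S (iX y₂) (iX y₁)            ≡⟨ rel-inv S (iX y₁) (iX y₂) ⟩
    inv S (iS u)                     ∎
    where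
    open ≡-Reasoning
    y₁ = proj₁ (rep U u)
    y₂ = proj₂ (rep U u)

  t·ui-unique : ∀ {t u x w y x' w' y'} → T̃ t →
                rel S x w ≡ t → rel S w y ≡ iS u →
                rel S x' w' ≡ t → rel S w' y' ≡ iS u → rel S x y ≡ rel S x' y'
  t·ui-unique {t} {u} t∈T̃ e₁ e₂ e₃ e₄ =
    let (_ , t·ui≡r) = single u t t∈T̃
    in trans (proj₁ (t·ui≡r _) (InProd-intro e₁ e₂))
             (sym (proj₁ (t·ui≡r _) (InProd-intro e₃ e₄)))

  -- Mirror image of t·ui-unique: |(ui)t| = 1 is the inverse of |t*(u*i)| = 1.
  ui·t-unique : ∀ {t u x w y x' w' y'} → T̃ t →
                rel S x w ≡ iS u → rel S w y ≡ t →
                rel S x' w' ≡ iS u → rel S w' y' ≡ t → rel S x y ≡ rel S x' y'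
  ui·t-unique {t} {u} t∈T̃ e₁ e₂ e₃ e₄ =
    rel-flip-≡ (t·ui-unique (coset-sym (subst T̃ (sym e₂) t∈T̃))
                            refl (ui*-step e₁)
                            (trans (rel-flip e₄) (sym (rel-flip e₂))) (ui*-step e₃))
    where
    ui*-step : ∀ {a b} → rel S a b ≡ iS u → rel S b a ≡ iS (inv U u)
    ui*-step e = trans (rel-flip e) (sym (iS-inv u))

  iS-QuotRel-injective : ∀ {u u' a b} →
    QuotRel S T̃ (iS u) a b → QuotRel S T̃ (iS u') a b → u ≡ u'
  iS-QuotRel-injective h₁ h₂ =
    iπ-rel-inj _ _ (λ _ _ → QuotRel-overlap⇒⊆ h₁ h₂ , QuotRel-overlap⇒⊆ h₂ h₁)

  cosetIndex : Fin nZ → Fin nY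
  cosetIndex z = proj₁ (iπ-pts-onto z)

  cosetIndex-coset : ∀ z → InCoset S T̃ (iX (cosetIndex z)) z
  cosetIndex-coset z = proj₂ (iπ-pts-onto z)

  cosetIndex-unique : ∀ {y z} → InCoset S T̃ (iX y) z → cosetIndex z ≡ y
  cosetIndex-unique h =
    iπ-pts-inj _ _ (coset-trans (cosetIndex-coset _) (coset-sym h))

  cosetCoord : Fin nZ → Fin nX
  cosetCoord z = proj₁ (g-onto (cosetIndex z) z (cosetIndex-coset z))

  g-cosetCoord : ∀ z → g (cosetIndex z) (cosetCoord z) ≡ z
  g-cosetCoord z = proj₂ (g-onto (cosetIndex z) z (cosetIndex-coset z))

  coords : Fin nZ → Fin nY × Fin nX
  coords z = cosetIndex z , cosetCoord z

  coords-bijective : IsBij coords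
  coords-bijective = injective , surjective
    where
    injective : ∀ z z' → coords z ≡ coords z' → z ≡ z'
    injective z z' e =
      trans (sym (g-cosetCoord z))
            (trans (cong (λ p → g (proj₁ p) (proj₂ p)) e) (g-cosetCoord z'))
    surjective : ∀ p → ∃ λ z → coords z ≡ p
    surjective (y , x) = g y x , cong₂ _,_ index≡y (g-inj y _ x g-coord)
      where
      index≡y : cosetIndex (g y x) ≡ y
      index≡y = cosetIndex-unique (g-into y x)
      g-coord : g y (cosetCoord (g y x)) ≡ g y x
      g-coord = subst (λ v → g v (cosetCoord (g y x)) ≡ g y x) index≡y
                      (g-cosetCoord (g y x))

  QuotRel-cosetIndex : ∀ a b →
    QuotRel S T̃ (iS (rel U (cosetIndex a) (cosetIndex b))) a b
  QuotRel-cosetIndex a b =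
      iX (cosetIndex a) , iX (cosetIndex b)
    , coset-sym (cosetIndex-coset a) , coset-sym (cosetIndex-coset b)
    , sym (iS-rel _ _)

  cosetIndex-rel-invariant : ∀ {z₁ z₂ z₁' z₂'} →
    rel S z₁' z₂' ≡ rel S z₁ z₂ →
    rel U (cosetIndex z₁') (cosetIndex z₂') ≡ rel U (cosetIndex z₁) (cosetIndex z₂)
  cosetIndex-rel-invariant {z₁} {z₂} {z₁'} {z₂'} e =
    iS-QuotRel-injective (QuotRel-cosetIndex z₁' z₂')
      (QuotRel-overlap⇒⊆ (z₁ , z₂ , coset-refl z₁ , coset-refl z₂ , refl)
                         (QuotRel-cosetIndex z₁ z₂)
                         (z₁' , z₂' , coset-refl z₁' , coset-refl z₂' , e))

  -- Some ui-successor w₀ of z lies in a coset (yi)T̃ with u = rel U y₁ y by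
  -- injectivity of iπ, and |t(ui)| = 1 then moves it into the coset of y₂.
  coset-step : ∀ y₁ y₂ z → InCoset S T̃ (iX y₁) z →
               ∃ λ w → InCoset S T̃ (iX y₂) w × rel S z w ≡ iS (rel U y₁ y₂)
  coset-step y₁ y₂ z z∈ =
    let (w , f₁ , f₂) = path-transport {z = w₀} z→y≡z→y₂ refl refl
    in w , coset-sym (subst T̃ (sym f₂) (coset-sym w₀∈)) , trans f₁ z→w₀
    where
    u = rel U y₁ y₂
    w₀ = proj₁ (successor-exists z (iS u))
    z→w₀ = proj₂ (successor-exists z (iS u))
    y = cosetIndex w₀
    w₀∈ = cosetIndex-coset w₀
    u≡y₁→y : u ≡ rel U y₁ y
    u≡y₁→y = iS-QuotRel-injective (z , w₀ , z∈ , w₀∈ , z→w₀)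
               (iX y₁ , iX y , coset-refl _ , coset-refl _ , sym (iS-rel y₁ y))
    z→y≡z→y₂ : rel S z (iX y) ≡ rel S z (iX y₂)
    z→y≡z→y₂ = t·ui-unique (coset-sym z∈) refl
                 (trans (sym (iS-rel y₁ y)) (cong iS (sym u≡y₁→y)))
                 refl (sym (iS-rel y₁ y₂))

  -- The last hypothesis says s ∈ T̃″_u.
  T̃″-absorbed : ∀ y₁ y₂ z b b' s →
    InCoset S T̃ (iX y₁) z → InCoset S T̃ (iX y₂) b → rel S b b' ≡ s →
    (∀ r → InProd S r (iS (rel U y₁ y₂)) s → r ≡ iS (rel U y₁ y₂)) →
    rel S z b ≡ rel S z b'
  T̃″-absorbed y₁ y₂ z b b' s z∈ b∈ b→b' ui·s⊆ui =
    t·ui-unique (coset-trans (coset-sym z∈) z'∈) refl z'→b refl z'→b'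
    where
    step = coset-step y₂ y₁ b b∈
    z' = proj₁ step
    z'∈ = proj₁ (proj₂ step)
    z'→b : rel S z' b ≡ iS (rel U y₁ y₂)
    z'→b = trans (rel-flip (proj₂ (proj₂ step)))
             (trans (sym (iS-inv _)) (cong iS (sym (rel-inv U y₂ y₁))))
    z'→b' : rel S z' b' ≡ iS (rel U y₁ y₂)
    z'→b' = ui·s⊆ui _ (InProd-intro z'→b b→b')

  InT″-refl : ∀ y₁ y₂ x → InT″ y₁ y₂ x x
  InT″-refl y₁ y₂ x =
      one T
    , (γS-into (one T) , λ r → subst (λ v → InProd S r (iS u) v iff (r ≡ iS u))
                                      (sym γS-one) (InProd-oneʳ r _))
    , trans (rel-diag _) (sym γS-one)
    where
    u = rel U y₁ y₂

  module _ {z₁ z₂ a₀ : Fin nZ} {s : Fin (m S)} {u : Fin (m U)} {t : τ}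
           (z₁→z₂ : rel S z₁ z₂ ≡ s)
           (index-rel : rel U (cosetIndex z₁) (cosetIndex z₂) ≡ u)
           (z₁→a₀ : rel S z₁ a₀ ≡ iS u) (a₀→z₂ : rel S a₀ z₂ ≡ γS t)
           (z₁' z₂' : Fin nZ) where
    private
      y₁' = cosetIndex z₁'
      y₂' = cosetIndex z₂'

    Bracket-complete : rel S z₁' z₂' ≡ s → Bracket u t (coords z₁') (coords z₂')
    Bracket-complete e =
        index-rel'
      , x'
      , ( trans (cong₂ (rel S) (g-cosetCoord z₁') gx'≡w)
                (trans z₁'→w (cong iS (sym index-rel')))
        , g-into y₂' x')
      , x' , cosetCoord z₂'
      , InT″-refl y₁' y₂' x' , InT″-refl y₁' y₂' (cosetCoord z₂')
      , trans (cong₂ (rel S) gx'≡w (g-cosetCoord z₂')) w→z₂'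
      where
      z₁'z₂'≡z₁z₂ = trans e (sym z₁→z₂)
      index-rel' = trans (cosetIndex-rel-invariant z₁'z₂'≡z₁z₂) index-rel
      path = path-transport {z = a₀} (sym z₁'z₂'≡z₁z₂) z₁→a₀ a₀→z₂
      w = proj₁ path
      z₁'→w = proj₁ (proj₂ path)
      w→z₂' = proj₂ (proj₂ path)
      w∈ : InCoset S T̃ (iX y₂') w
      w∈ = coset-trans (cosetIndex-coset z₂')
                       (coset-sym (subst T̃ (sym w→z₂') (γS-into t)))
      x' = proj₁ (g-onto y₂' w w∈)
      gx'≡w = proj₂ (g-onto y₂' w w∈)

    Bracket-sound : Bracket u t (coords z₁') (coords z₂') → rel S z₁' z₂' ≡ s
    Bracket-sound (index-rel' , x' , (z₁'→gx' , _) , a , b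
                  , (t₁ , (_ , ui·t₁≡ui) , gx'→ga)
                  , (t₂ , (_ , ui·t₂≡ui) , z₂'→gb)
                  , ga→gb) =
      trans z₁'z₂'≡z₁'gb (trans (sym z₁z₂≡z₁'gb) z₁→z₂)
      where
      z₁'→ga : rel S z₁' (g y₂' a) ≡ iS u
      z₁'→ga =
        trans (proj₁ (ui·t₁≡ui _) (InProd-intro z₁'→gx'' gx'→ga)) (cong iS index-rel')
        where
        z₁'→gx'' : rel S z₁' (g y₂' x') ≡ iS (rel U y₁' y₂')
        z₁'→gx'' = subst (λ v → rel S v (g y₂' x') ≡ iS (rel U y₁' y₂'))
                         (g-cosetCoord z₁') z₁'→gx'
      z₁z₂≡z₁'gb : rel S z₁ z₂ ≡ rel S z₁' (g y₂' b)
      z₁z₂≡z₁'gb = ui·t-unique (γS-into t) z₁→a₀ a₀→z₂ z₁'→ga ga→gb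
      z₁'z₂'≡z₁'gb : rel S z₁' z₂' ≡ rel S z₁' (g y₂' b)
      z₁'z₂'≡z₁'gb =
        T̃″-absorbed y₁' y₂' z₁' z₂' (g y₂' b) (γS t₂)
          (cosetIndex-coset z₁') (cosetIndex-coset z₂')
          (subst (λ v → rel S v (g y₂' b) ≡ _) (g-cosetCoord z₂') z₂'→gb)
          (λ r → proj₁ (ui·t₂≡ui r))

    rel-iff-Bracket : (rel S z₁' z₂' ≡ s) iff Bracket u t (coords z₁') (coords z₂')
    rel-iff-Bracket = Bracket-complete , Bracket-sound

  relation-to-bracket : ∀ s → ∃ λ u → ∃ λ t → ∀ z₁ z₂ →
    (rel S z₁ z₂ ≡ s) iff Bracket u t (coords z₁) (coords z₂)
  relation-to-bracket s =
    _ , t , rel-iff-Bracket (rep-ok S s) refl z₁→a₀ (sym γt≡a₀→z₂)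
    where
    z₁ = proj₁ (rep S s)
    z₂ = proj₂ (rep S s)
    step = coset-step (cosetIndex z₁) (cosetIndex z₂) z₁ (cosetIndex-coset z₁)
    a₀ = proj₁ step
    z₁→a₀ = proj₂ (proj₂ step)
    a₀→z₂∈T̃ = coset-trans (coset-sym (proj₁ (proj₂ step))) (cosetIndex-coset z₂)
    t = proj₁ (γS-onto _ a₀→z₂∈T̃)
    γt≡a₀→z₂ = proj₂ (γS-onto _ a₀→z₂∈T̃)

  bracket-to-relation : ∀ u t → ∃ λ s → ∀ z₁ z₂ →
    (rel S z₁ z₂ ≡ s) iff Bracket u t (coords z₁) (coords z₂)
  bracket-to-relation u t =
    _ , rel-iff-Bracket refl index-rel (trans iy₁→a₀ (cong iS (rep-ok U u))) a₀→b
    where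
    y₁ = proj₁ (rep U u)
    y₂ = proj₂ (rep U u)
    step = coset-step y₁ y₂ (iX y₁) (coset-refl _)
    a₀ = proj₁ step
    iy₁→a₀ = proj₂ (proj₂ step)
    b = proj₁ (successor-exists a₀ (γS t))
    a₀→b = proj₂ (successor-exists a₀ (γS t))
    b∈ : InCoset S T̃ (iX y₂) b
    b∈ = coset-trans (proj₁ (proj₂ step)) (subst T̃ (sym a₀→b) (γS-into t))
    index-rel : rel U (cosetIndex (iX y₁)) (cosetIndex b) ≡ u
    index-rel = trans (cong₂ (rel U) (cosetIndex-unique (coset-refl _))
                                     (cosetIndex-unique b∈))
                      (rep-ok U u)

theorem7p20 : (σ : Setting) (c : Choices σ) → Construction.IsoToSemidirect σ c
theorem7p20 σ c = coords , coords-bijective , relation-to-bracket , bracket-to-relation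
  where open SemidirectDecomposition σ c
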